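{- Let $M\geq1$ and $\rho<M$. Then there exist a finite ground set $E$, weights $w\colon E\to\mathbb{R}_{\geq0}$ and a monotone, $M$-bounded, fractionally subadditive objective $f\colon2^{E}\to\mathbb{R}_{\geq0}$ such that no incremental solution (ordering of $E$) is $\rho$-competitive.
   Context: $w(S):=\sum_{e\in S}w(e)$; $f^{*}(C):=\max\{f(S):S\subseteq E,w(S)\leq C\}$. An incremental solution is an ordering $\pi=(e_{\pi(1)},\dots,e_{\pi(m)})$ of $E$; $\pi(C)$ is the maximal prefix $\{e_{\pi(1)},\dots,e_{\pi(k)}\}$ with total weight at most $C$; $\pi$ is $\rho$-competitive if $f^{*}(C)\leq\rho f(\pi(C))$ for all $C>0$. Monotone: $f(A)\geq f(B)$ for $A\supseteq B$; $M$-bounded: $f(\{e\})\in[1,M]$ for all $e$; fractionally subadditive: $f(A)\leq\sum_{i}\alpha_{i}f(B_{i})$ for all $A,B_{1},\dots,B_{k}\subseteq E$ and $\alpha_{i}\geq0$ with $\sum_{i:e\in B_{i}}\alpha_{i}\geq1$ for all $e\in A$.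
   Formalization: The parameters M and ρ range over ℚ; the weights, the values of f and the capacities C are taken in ℚ, and the coefficients $\alpha_{i}$ in fractional subadditivity are rational. -}

module Defs where

open import Data.Bool using (Bool; true; false; if_then_else_)
open import Data.Nat as ℕ using (ℕ; zero; suc)
open import Data.Fin using (Fin; zero; suc; toℕ)
open import Data.Fin.Subset using (Subset; _∈_; _⊆_; ⁅_⁆)
open import Data.Fin.Permutation using (Permutation′; _⟨$⟩ˡ_)
open import Data.Vec using (lookup; tabulate)
open import Data.Product using (_×_; Σ; ∃)
open import Data.Rational using (ℚ; 0ℚ; 1ℚ; _+_; _*_; _≤_; _<_; _≤ᵇ_)

sumFin : ∀ {k} → (Fin k → ℚ) → ℚ
sumFin {zero}  g = 0ℚ
sumFin {suc k} g = g zero + sumFin {k} (λ i → g (suc i))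

weight : ∀ {n} → (Fin n → ℚ) → Subset n → ℚ
weight w S = sumFin (λ e → if lookup S e then w e else 0ℚ)

Monotone : ∀ {n} → (Subset n → ℚ) → Set
Monotone {n} f = (A B : Subset n) → B ⊆ A → f B ≤ f A

Bounded : ∀ {n} → ℚ → (Subset n → ℚ) → Set
Bounded {n} M f = (e : Fin n) → (1ℚ ≤ f ⁅ e ⁆) × (f ⁅ e ⁆ ≤ M)

FractionallySubadditive : ∀ {n} → (Subset n → ℚ) → Set
FractionallySubadditive {n} f =
  (k : ℕ) (A : Subset n) (B : Fin k → Subset n) (α : Fin k → ℚ) →
  ((i : Fin k) → 0ℚ ≤ α i) →
  ((e : Fin n) → e ∈ A → 1ℚ ≤ sumFin (λ i → if lookup (B i) e then α i else 0ℚ)) →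
  f A ≤ sumFin (λ i → α i * f (B i))

-- An ordering π of E = Fin n: π ⟨$⟩ʳ j is the element at position j,
-- π ⟨$⟩ˡ e is the position of element e.
-- prefix π k = {e_{π(1)}, …, e_{π(k)}} (first k elements).
prefix : ∀ {n} → Permutation′ n → ℕ → Subset n
prefix π k = tabulate (λ e → toℕ (π ⟨$⟩ˡ e) ℕ.<ᵇ k)

maxPrefixLen : ∀ {n} → (Fin n → ℚ) → Permutation′ n → ℚ → ℕ → ℕ
maxPrefixLen w π C zero    = zero
maxPrefixLen w π C (suc k) =
  if weight w (prefix π (suc k)) ≤ᵇ C then suc k else maxPrefixLen w π C k

incrementalSolution : ∀ {n} → (Fin n → ℚ) → Permutation′ n → ℚ → Subset n
incrementalSolution {n} w π C = prefix π (maxPrefixLen w π C n)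

-- π is ρ-competitive: f*(C) ≤ ρ f(π(C)) for all C > 0, where
-- f*(C) = max{ f(S) : w(S) ≤ C } (so f*(C) ≤ x iff every feasible S has f(S) ≤ x)
Competitive : ∀ {n} → (Fin n → ℚ) → (Subset n → ℚ) → ℚ → Permutation′ n → Set
Competitive {n} w f ρ π =
  (C : ℚ) → 0ℚ < C → (S : Subset n) → weight w S ≤ C →
  f S ≤ ρ * f (incrementalSolution w π C)

{-# OPTIONS --safe #-}
-- Two elements suffice: a heavy one of weight 1 and value M and a light one
-- of weight ½ and value 1, valued by f(S) = max_{e ∈ S} value(e).  This f is
-- fractionally subadditive since f(A) = value(e) for some e ∈ A, and every
-- B_i containing e has f(B_i) ≥ value(e), so covering e gives
-- f(A) ≤ Σ α_i f(B_i).  An ordering starting with the heavy element has the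
-- empty prefix at budget ½, where the light element alone is affordable; one
-- starting with the light element has prefix {light} at budget 1, where the
-- heavy element alone is affordable and worth M > ρ · 1.
module Submission where

open import Defs
open import Data.Bool using (true; false; if_then_else_)
open import Data.Nat using (ℕ)
open import Data.Fin using (Fin; zero; suc)
open import Data.Fin.Subset using (Subset; _∈_; ⊥; ⁅_⁆)
open import Data.Fin.Subset.Properties using (x∈⁅x⁆; x∈⁅y⁆⇒x≡y)
open import Data.Fin.Permutation using (Permutation′; _⟨$⟩ˡ_; _⟨$⟩ʳ_; inverseʳ)
open import Data.Vec using ([]; _∷_; lookup; here; there)
open import Data.Vec.Properties using (lookup⇒[]=)
open import Data.Product using (_×_; Σ; ∃; _,_; proj₁)
open import Data.Sum using (_⊎_; inj₁; inj₂; map₂)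
open import Data.Rational
  using (ℚ; 0ℚ; 1ℚ; ½; _+_; _*_; _⊔_; _≤_; _<_; nonNegative)
open import Data.Rational.Properties
open import Function using (_∘_)
open import Relation.Binary.PropositionalEquality
open import Relation.Nullary using (¬_)

*-nonNeg : {p q : ℚ} → 0ℚ ≤ p → 0ℚ ≤ q → 0ℚ ≤ p * q
*-nonNeg {p} {q} 0≤p 0≤q =
  nonNegative⁻¹ (p * q) {{nonNeg*nonNeg⇒nonNeg p {{nonNegative 0≤p}} q {{nonNegative 0≤q}}}}

sumFin-mono : ∀ {k} {g h : Fin k → ℚ} → (∀ i → g i ≤ h i) → sumFin g ≤ sumFin h
sumFin-mono {ℕ.zero}  g≤h = ≤-refl
sumFin-mono {ℕ.suc k} g≤h = +-mono-≤ (g≤h zero) (sumFin-mono (g≤h ∘ suc))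

sumFin-nonNeg : ∀ {k} {g : Fin k → ℚ} → (∀ i → 0ℚ ≤ g i) → 0ℚ ≤ sumFin g
sumFin-nonNeg {ℕ.zero}  0≤g = ≤-refl
sumFin-nonNeg {ℕ.suc k} 0≤g = +-mono-≤ (0≤g zero) (sumFin-nonNeg (0≤g ∘ suc))

*-distribˡ-sumFin : ∀ {k} c (g : Fin k → ℚ) → c * sumFin g ≡ sumFin (λ i → c * g i)
*-distribˡ-sumFin {ℕ.zero}  c g = *-zeroʳ c
*-distribˡ-sumFin {ℕ.suc k} c g = begin
  c * (g zero + sumFin (g ∘ suc))         ≡⟨ *-distribˡ-+ c (g zero) _ ⟩
  c * g zero + c * sumFin (g ∘ suc)       ≡⟨ cong (c * g zero +_) (*-distribˡ-sumFin c (g ∘ suc)) ⟩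
  c * g zero + sumFin (λ i → c * g (suc i)) ∎
  where open ≡-Reasoning

unitDemand : ∀ {n} → (Fin n → ℚ) → Subset n → ℚ
unitDemand v []          = 0ℚ
unitDemand v (true ∷ S)  = v zero ⊔ unitDemand (v ∘ suc) S
unitDemand v (false ∷ S) = unitDemand (v ∘ suc) S

unitDemand-nonNeg : ∀ {n} (v : Fin n → ℚ) S → 0ℚ ≤ unitDemand v S
unitDemand-nonNeg v []          = ≤-refl
unitDemand-nonNeg v (true ∷ S)  = p≤q⇒p≤r⊔q (v zero) (unitDemand-nonNeg (v ∘ suc) S)
unitDemand-nonNeg v (false ∷ S) = unitDemand-nonNeg (v ∘ suc) S

∈⇒≤unitDemand : ∀ {n} (v : Fin n → ℚ) {S e} → e ∈ S → v e ≤ unitDemand v S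
∈⇒≤unitDemand v {true ∷ S}  here      = p≤p⊔q (v zero) _
∈⇒≤unitDemand v {true ∷ S}  (there p) = p≤q⇒p≤r⊔q (v zero) (∈⇒≤unitDemand (v ∘ suc) p)
∈⇒≤unitDemand v {false ∷ S} (there p) = ∈⇒≤unitDemand (v ∘ suc) p

unitDemand-attained : ∀ {n} (v : Fin n → ℚ) S →
  unitDemand v S ≡ 0ℚ ⊎ ∃ λ e → e ∈ S × unitDemand v S ≡ v e
unitDemand-attained v []          = inj₁ refl
unitDemand-attained v (false ∷ S) =
  map₂ (λ (e , e∈S , eq) → suc e , there e∈S , eq) (unitDemand-attained (v ∘ suc) S)
unitDemand-attained v (true ∷ S) with ⊔-sel (v zero) (unitDemand (v ∘ suc) S)
... | inj₁ eq = inj₂ (zero , here , eq)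
... | inj₂ eq with unitDemand-attained (v ∘ suc) S
...   | inj₁ eq₀              = inj₁ (trans eq eq₀)
...   | inj₂ (e , e∈S , eqₑ) = inj₂ (suc e , there e∈S , trans eq eqₑ)

unitDemand-monotone : ∀ {n} (v : Fin n → ℚ) → Monotone (unitDemand v)
unitDemand-monotone v A B B⊆A with unitDemand-attained v B
... | inj₁ eq             = ≤-trans (≤-reflexive eq) (unitDemand-nonNeg v A)
... | inj₂ (e , e∈B , eq) = ≤-trans (≤-reflexive eq) (∈⇒≤unitDemand v (B⊆A e∈B))

unitDemand-⁅⁆ : ∀ {n} (v : Fin n → ℚ) {e} → 0ℚ ≤ v e → unitDemand v ⁅ e ⁆ ≡ v e
unitDemand-⁅⁆ v {e} 0≤v with unitDemand-attained v ⁅ e ⁆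
... | inj₁ eq = ≤-antisym (≤-trans (≤-reflexive eq) 0≤v) (∈⇒≤unitDemand v (x∈⁅x⁆ e))
... | inj₂ (e′ , e′∈⁅e⁆ , eq) = trans eq (cong v (x∈⁅y⁆⇒x≡y e e′∈⁅e⁆))

unitDemand-bounded : ∀ {n} {M} (v : Fin n → ℚ) →
  (∀ e → 1ℚ ≤ v e × v e ≤ M) → Bounded M (unitDemand v)
unitDemand-bounded v 1≤v≤M e
  rewrite unitDemand-⁅⁆ v (≤-trans (nonNegative⁻¹ 1ℚ) (proj₁ (1≤v≤M e))) = 1≤v≤M e

unitDemand-fractionallySubadditive : ∀ {n} (v : Fin n → ℚ) →
  FractionallySubadditive (unitDemand v)
unitDemand-fractionallySubadditive v k A B α 0≤α covers
  with unitDemand-attained v A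
... | inj₁ eq = ≤-trans (≤-reflexive eq) (sumFin-nonNeg 0≤αf)
  where
  0≤αf : ∀ i → 0ℚ ≤ α i * unitDemand v (B i)
  0≤αf i = *-nonNeg (0≤α i) (unitDemand-nonNeg v (B i))
... | inj₂ (e , e∈A , eq) = begin
  unitDemand v A                           ≡⟨ eq ⟩
  v e                                      ≡⟨ sym (*-identityʳ (v e)) ⟩
  v e * 1ℚ                                 ≤⟨ *-monoˡ-≤-nonNeg (v e) {{nonNegative 0≤v}} (covers e e∈A) ⟩
  v e * sumFin share                       ≡⟨ *-distribˡ-sumFin (v e) share ⟩
  sumFin (λ i → v e * share i)             ≤⟨ sumFin-mono term≤ ⟩
  sumFin (λ i → α i * unitDemand v (B i))  ∎
  where
  open ≤-Reasoning
  share : Fin k → ℚ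
  share i = if lookup (B i) e then α i else 0ℚ
  0≤v : 0ℚ ≤ v e
  0≤v = subst (0ℚ ≤_) eq (unitDemand-nonNeg v A)
  term≤ : ∀ i → v e * share i ≤ α i * unitDemand v (B i)
  term≤ i with lookup (B i) e in e∈Bᵢ
  ... | true  = begin
    v e * α i                  ≡⟨ *-comm (v e) (α i) ⟩
    α i * v e                  ≤⟨ *-monoˡ-≤-nonNeg (α i) {{nonNegative (0≤α i)}}
                                    (∈⇒≤unitDemand v (lookup⇒[]= e (B i) e∈Bᵢ)) ⟩
    α i * unitDemand v (B i)   ∎
  ... | false = begin
    v e * 0ℚ                   ≡⟨ *-zeroʳ (v e) ⟩
    0ℚ                         ≤⟨ *-nonNeg (0≤α i) (unitDemand-nonNeg v (B i)) ⟩
    α i * unitDemand v (B i)   ∎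

⟨$⟩ˡ-injective : ∀ {n} (π : Permutation′ n) {i j} → π ⟨$⟩ˡ i ≡ π ⟨$⟩ˡ j → i ≡ j
⟨$⟩ˡ-injective π eq = trans (sym (inverseʳ π)) (trans (cong (π ⟨$⟩ʳ_) eq) (inverseʳ π))

pattern heavy = zero
pattern light = suc zero

weights : Fin 2 → ℚ
weights heavy = 1ℚ
weights light = ½

weights-nonNeg : ∀ e → 0ℚ ≤ weights e
weights-nonNeg heavy = nonNegative⁻¹ 1ℚ
weights-nonNeg light = nonNegative⁻¹ ½

values : ℚ → Fin 2 → ℚ
values M heavy = M
values M light = 1ℚ

permutation₂-cases : (π : Permutation′ 2) →
  (π ⟨$⟩ˡ heavy ≡ zero × π ⟨$⟩ˡ light ≡ suc zero) ⊎
  (π ⟨$⟩ˡ heavy ≡ suc zero × π ⟨$⟩ˡ light ≡ zero)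
permutation₂-cases π with π ⟨$⟩ˡ heavy in p | π ⟨$⟩ˡ light in q
... | zero     | suc zero = inj₁ (refl , refl)
... | suc zero | zero     = inj₂ (refl , refl)
... | zero     | zero     with () ← ⟨$⟩ˡ-injective π (trans p (sym q))
... | suc zero | suc zero with () ← ⟨$⟩ˡ-injective π (trans p (sym q))

solution-heavyFirst : (π : Permutation′ 2) → π ⟨$⟩ˡ heavy ≡ zero → π ⟨$⟩ˡ light ≡ suc zero →
  incrementalSolution weights π ½ ≡ ⊥
solution-heavyFirst π p q rewrite p | q = refl

solution-lightFirst : (π : Permutation′ 2) → π ⟨$⟩ˡ heavy ≡ suc zero → π ⟨$⟩ˡ light ≡ zero →
  incrementalSolution weights π 1ℚ ≡ ⁅ light ⁆
solution-lightFirst π p q rewrite p | q = refl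

valuation : ℚ → Subset 2 → ℚ
valuation M = unitDemand (values M)

module _ {M : ℚ} (1≤M : 1ℚ ≤ M) where

  values-bounded : ∀ e → 1ℚ ≤ values M e × values M e ≤ M
  values-bounded heavy = 1≤M , ≤-refl
  values-bounded light = ≤-refl , 1≤M

  valuation-⁅⁆ : ∀ e → valuation M ⁅ e ⁆ ≡ values M e
  valuation-⁅⁆ e = unitDemand-⁅⁆ (values M) {e} (≤-trans (nonNegative⁻¹ 1ℚ) (proj₁ (values-bounded e)))

  ¬competitive : ∀ {ρ} → ρ < M → (π : Permutation′ 2) → ¬ Competitive weights (valuation M) ρ π
  ¬competitive {ρ} ρ<M π competitive with permutation₂-cases π
  ... | inj₁ (p , q) = <-irrefl refl (begin-strict
    0ℚ                                                <⟨ positive⁻¹ 1ℚ ⟩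
    1ℚ                                                ≡⟨ sym (valuation-⁅⁆ light) ⟩
    valuation M ⁅ light ⁆                             ≤⟨ competitive ½ (positive⁻¹ ½) ⁅ light ⁆ ≤-refl ⟩
    ρ * valuation M (incrementalSolution weights π ½) ≡⟨ cong ((ρ *_) ∘ valuation M) (solution-heavyFirst π p q) ⟩
    ρ * 0ℚ                                            ≡⟨ *-zeroʳ ρ ⟩
    0ℚ                                                ∎)
    where open ≤-Reasoning
  ... | inj₂ (p , q) = <-irrefl refl (begin-strict
    M                                                  ≡⟨ sym (valuation-⁅⁆ heavy) ⟩
    valuation M ⁅ heavy ⁆                              ≤⟨ competitive 1ℚ (positive⁻¹ 1ℚ) ⁅ heavy ⁆ ≤-refl ⟩
    ρ * valuation M (incrementalSolution weights π 1ℚ) ≡⟨ cong ((ρ *_) ∘ valuation M) (solution-lightFirst π p q) ⟩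
    ρ * valuation M ⁅ light ⁆                          ≡⟨ cong (ρ *_) (valuation-⁅⁆ light) ⟩
    ρ * 1ℚ                                             ≡⟨ *-identityʳ ρ ⟩
    ρ                                                  <⟨ ρ<M ⟩
    M                                                  ∎)
    where open ≤-Reasoning

proposition1 : (M ρ : ℚ) → 1ℚ ≤ M → ρ < M →
    Σ ℕ λ n → Σ (Fin n → ℚ) λ w → Σ (Subset n → ℚ) λ f →
      ((e : Fin n) → 0ℚ ≤ w e) × ((S : Subset n) → 0ℚ ≤ f S) ×
      Monotone f × Bounded M f × FractionallySubadditive f ×
      ((π : Permutation′ n) → ¬ Competitive w f ρ π)
proposition1 M ρ 1≤M ρ<M =
  2 , weights , valuation M ,
  weights-nonNeg ,
  unitDemand-nonNeg (values M) ,
  unitDemand-monotone (values M) ,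
  unitDemand-bounded (values M) (values-bounded 1≤M) ,
  unitDemand-fractionallySubadditive (values M) ,
  ¬competitive 1≤M ρ<M
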